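{- Let $k$ be a positive integer and $d\in\mathbb{N}$. For every $L=(\mathcal{I},r,b,g)\in\mathsf{GLI}_k^d$ there is a pair $(F,\Gamma)$, where $F$ is a rooted forest of height at most $d$ and $\Gamma$ is a bijection from $V(F)$ to $B(\mathcal{I})\setminus\mathrm{img}(b)$, such that, writing $\tilde\Gamma(t)=\beta(\Gamma(t))\setminus\mathrm{img}(r)$: for all $s,t\in V(F)$ and all $v\in\tilde\Gamma(s)\cap\tilde\Gamma(t)$, either $v\in\beta(b(j))$ for some $j\in\mathrm{dom}(b)$, or $\mathrm{lcv}(s,t)$ is defined and $v\in\bigcup_{p\in P(\mathrm{lcv}(s,t))}\tilde\Gamma(p)$.
   Context: An incidence graph is $\mathcal{I}=(R(\mathcal{I}),B(\mathcal{I}),E(\mathcal{I}))$ with disjoint finite sets of red and blue vertices and $E(\mathcal{I})\subseteq B(\mathcal{I})\times R(\mathcal{I})$, every red vertex having a blue neighbour; $\beta(e)$ is the set of red neighbours of blue $e$. For a rooted forest $F$: $\le_F$ is the tree order (roots minimal), $P(s)$ the node set of the path from $s$ to its root, $\mathrm{lcv}(s,t)$ the $\le_F$-maximum of $P(s)\cap P(t)$ (defined iff $s,t$ lie in the same tree), height = maximal $|P(s)|$ (0 for the empty forest). $k$-labeled incidence graphs: $L=(\mathcal{I},r,b,g)$ with $r$ a partial map from positive integers to $R(\mathcal{I})$ with finite domain, $b\colon\{1,\dots,k\}\rightharpoonup B(\mathcal{I})$, $g$ a partial map from positive integers to $\{1,\dots,k\}$ with $\mathrm{dom}(g)=\mathrm{dom}(r)$.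 Real guards: for all $i\in\mathrm{dom}(r)$, $g(i)\in\mathrm{dom}(b)$ and $(b(g(i)),r(i))\in E(\mathcal{I})$. Partial maps are compatible if they agree on their common domain. Operations: removing red labels $X_r\subseteq\mathrm{dom}(r)$ restricts $r,g$ to $\mathrm{dom}(r)\setminus X_r$; removing blue labels $X_b$ restricts $b$ to $\mathrm{dom}(b)\setminus X_b$; glueing $L_1\cdot L_2$ takes the disjoint union of skeletons and identifies (transitively) $r_1(j)$ with $r_2(j)$ for $j\in\mathrm{dom}(r_1)\cap\mathrm{dom}(r_2)$ and $b_1(j)$ with $b_2(j)$ for $j\in\mathrm{dom}(b_1)\cap\mathrm{dom}(b_2)$ (merged vertices inherit all incidences), with induced label maps on the union of domains and $g=g_1\cup g_2$ ($g_1$ taking precedence); a transition for $L$ is a partial map $f$ from positive integers to $\{1,\dots,k\}$ with $\emptyset\ne\mathrm{dom}(f)\subseteq\mathrm{dom}(g)$ such that every $i\in\mathrm{dom}(g)$ with $g(i)\in\mathrm{img}(f)$ is in $\mathrm{dom}(f)$; $M_f$ has red $v_i$ ($i\in\mathrm{dom}f$), blue $e_j$ ($j\in\mathrm{img}f$), edges $(e_{f(i)},v_i)$, $r(i)=v_i$, $b(j)=e_j$, $g=f$; and $L[f]=M_f\cdot L'$ where $L'$ is $L$ with blue labels $\mathrm{img}(g)\cap\mathrm{img}(f)\cap\mathrm{dom}(b)$ removed. Classes $\mathsf{GLI}_k^i$ are the smallest sets with: every $L$ with real guards in which every red and every blue vertex carries a label lies in $\mathsf{GLI}_k^0$; $\mathsf{GLI}_k^i\subseteq\mathsf{GLI}_k^{i+1}$;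 glueing $L_1\in\mathsf{GLI}_k^{i_1}$, $L_2\in\mathsf{GLI}_k^{i_2}$ with compatible guard functions gives an element of $\mathsf{GLI}_k^{\max(i_1,i_2)}$; for $L\in\mathsf{GLI}_k^i$ and a transition $f$, $L[f]\in\mathsf{GLI}_k^{i+|\mathrm{img}(f)\cap\mathrm{dom}(b)\cap\mathrm{img}(g)|}$; removing any red labels keeps $L$ in $\mathsf{GLI}_k^i$; removing blue labels $X_b\subseteq\mathrm{dom}(b)\setminus\mathrm{img}(g)$ gives an element of $\mathsf{GLI}_k^{i+|X_b|}$. -}

module Defs where

open import Data.Nat using (ℕ; zero; suc; _+_; _≤_; _⊔_)
open import Data.Fin using (Fin; zero; suc)
import Data.Fin as Fin
open import Data.Bool using (Bool; true; false; if_then_else_; _∧_; _∨_)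
open import Data.Maybe using (Maybe; just; nothing; is-just; _<∣>_)
import Data.Maybe as Maybe
open import Data.Product using (Σ; ∃; ∃-syntax; _×_; _,_)
open import Data.Sum using (_⊎_; inj₁; inj₂)
open import Data.Empty using (⊥)
open import Relation.Binary.PropositionalEquality using (_≡_; refl)
open import Relation.Nullary using (¬_)
open import Relation.Nullary.Decidable using (⌊_⌋)

-- Red vertices are Fin nR, blue vertices are Fin nB, E e v = true means
-- (e , v) ∈ E(I).  Label i ∈ ℕ stands for the positive integer i+1;
-- blue labels {1,…,k} are Fin k.

record LIG (k : ℕ) : Set where
  field
    nR nB     : ℕ
    E         : Fin nB → Fin nR → Bool
    redHasNbr : ∀ v → ∃[ e ] (E e v ≡ true)
    r : ℕ → Maybe (Fin nR)
    b : Fin k → Maybe (Fin nB)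
    g : ℕ → Maybe (Fin k)
    bound : ℕ
    r-fin : ∀ i → bound ≤ i → r i ≡ nothing
    dom-g₁ : ∀ i → r i ≡ nothing → g i ≡ nothing
    dom-g₂ : ∀ i → g i ≡ nothing → r i ≡ nothing

open LIG public

RealGuards : ∀ {k} → LIG k → Set
RealGuards L = ∀ i j → g L i ≡ just j →
  ∃[ e ] (b L j ≡ just e × ∃[ v ] (r L i ≡ just v × E L e v ≡ true))

AllLabelled : ∀ {k} → LIG k → Set
AllLabelled L = (∀ v → ∃[ i ] (r L i ≡ just v)) × (∀ e → ∃[ j ] (b L j ≡ just e))

Compatible : ∀ {k} → (ℕ → Maybe (Fin k)) → (ℕ → Maybe (Fin k)) → Set
Compatible h₁ h₂ = ∀ i a c → h₁ i ≡ just a → h₂ i ≡ just c → a ≡ c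

eqMF : ∀ {k} → Maybe (Fin k) → Fin k → Bool
eqMF nothing  _ = false
eqMF (just a) j = ⌊ a Fin.≟ j ⌋

anyBelow : ℕ → (ℕ → Bool) → Bool
anyBelow zero    p = false
anyBelow (suc n) p = p n ∨ anyBelow n p

-- j ∈ img(h), for h with domain inside {0,…,N-1}
imgᵇ : ∀ {k} → (ℕ → Maybe (Fin k)) → ℕ → Fin k → Bool
imgᵇ h N j = anyBelow N (λ i → eqMF (h i) j)

countB : ∀ {k} → (Fin k → Bool) → ℕ
countB {zero}  p = 0
countB {suc k} p = (if p zero then 1 else 0) + countB (λ j → p (suc j))

removeRed : ∀ {k} → LIG k → (ℕ → Bool) → LIG k
removeRed L X = record
  { nR = nR L ; nB = nB L ; E = E L ; redHasNbr = redHasNbr L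
  ; r = λ i → if X i then nothing else r L i
  ; b = b L
  ; g = λ i → if X i then nothing else g L i
  ; bound = bound L
  ; r-fin = λ i le → fin i le
  ; dom-g₁ = d₁ ; dom-g₂ = d₂ }
  where
  fin : ∀ i → bound L ≤ i → (if X i then nothing else r L i) ≡ nothing
  fin i le with X i
  ... | true  = refl
  ... | false = r-fin L i le
  d₁ : ∀ i → (if X i then nothing else r L i) ≡ nothing → (if X i then nothing else g L i) ≡ nothing
  d₁ i eq with X i
  ... | true  = refl
  ... | false = dom-g₁ L i eq
  d₂ : ∀ i → (if X i then nothing else g L i) ≡ nothing → (if X i then nothing else r L i) ≡ nothing
  d₂ i eq with X i
  ... | true  = refl
  ... | false = dom-g₂ L i eq

removeBlue : ∀ {k} → LIG k → (Fin k → Bool) → LIG k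
removeBlue L X = record
  { nR = nR L ; nB = nB L ; E = E L ; redHasNbr = redHasNbr L
  ; r = r L
  ; b = λ j → if X j then nothing else b L j
  ; g = g L
  ; bound = bound L ; r-fin = r-fin L ; dom-g₁ = dom-g₁ L ; dom-g₂ = dom-g₂ L }

-- Glueing, described up to isomorphism by a universal description:
-- L is (a copy of) L₁ · L₂.

data EqClo {A : Set} (R : A → A → Set) : A → A → Set where
  base  : ∀ {x y} → R x y → EqClo R x y
  refl′ : ∀ {x} → EqClo R x x
  sym′  : ∀ {x y} → EqClo R x y → EqClo R y x
  trans′ : ∀ {x y z} → EqClo R x y → EqClo R y z → EqClo R x z

RedId : ∀ {k} (L₁ L₂ : LIG k) → Fin (nR L₁) ⊎ Fin (nR L₂) → Fin (nR L₁) ⊎ Fin (nR L₂) → Set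
RedId L₁ L₂ x y = ∃[ j ] ∃[ a ] ∃[ c ] (r L₁ j ≡ just a × r L₂ j ≡ just c × x ≡ inj₁ a × y ≡ inj₂ c)

BlueId : ∀ {k} (L₁ L₂ : LIG k) → Fin (nB L₁) ⊎ Fin (nB L₂) → Fin (nB L₁) ⊎ Fin (nB L₂) → Set
BlueId {k} L₁ L₂ x y = ∃[ j ] ∃[ a ] ∃[ c ] (b L₁ j ≡ just a × b L₂ j ≡ just c × x ≡ inj₁ a × y ≡ inj₂ c)

SumEdge : ∀ {k} (L₁ L₂ : LIG k) → Fin (nB L₁) ⊎ Fin (nB L₂) → Fin (nR L₁) ⊎ Fin (nR L₂) → Set
SumEdge L₁ L₂ (inj₁ e) (inj₁ v) = E L₁ e v ≡ true
SumEdge L₁ L₂ (inj₂ e) (inj₂ v) = E L₂ e v ≡ true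
SumEdge L₁ L₂ (inj₁ e) (inj₂ v) = ⊥
SumEdge L₁ L₂ (inj₂ e) (inj₁ v) = ⊥

record IsGlue {k} (L₁ L₂ L : LIG k) : Set where
  field
    ρ : Fin (nR L₁) ⊎ Fin (nR L₂) → Fin (nR L)
    σ : Fin (nB L₁) ⊎ Fin (nB L₂) → Fin (nB L)
    ρ-surj : ∀ v → ∃[ x ] (ρ x ≡ v)
    σ-surj : ∀ e → ∃[ x ] (σ x ≡ e)
    ρ-ker₁ : ∀ x y → ρ x ≡ ρ y → EqClo (RedId L₁ L₂) x y
    ρ-ker₂ : ∀ x y → EqClo (RedId L₁ L₂) x y → ρ x ≡ ρ y
    σ-ker₁ : ∀ x y → σ x ≡ σ y → EqClo (BlueId L₁ L₂) x y
    σ-ker₂ : ∀ x y → EqClo (BlueId L₁ L₂) x y → σ x ≡ σ y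
    E-img₁ : ∀ e v → E L e v ≡ true → ∃[ x ] ∃[ y ] (σ x ≡ e × ρ y ≡ v × SumEdge L₁ L₂ x y)
    E-img₂ : ∀ x y → SumEdge L₁ L₂ x y → E L (σ x) (ρ y) ≡ true
    r-def : ∀ i → r L i ≡ (Maybe.map (λ a → ρ (inj₁ a)) (r L₁ i) <∣> Maybe.map (λ a → ρ (inj₂ a)) (r L₂ i))
    b-def : ∀ j → b L j ≡ (Maybe.map (λ a → σ (inj₁ a)) (b L₁ j) <∣> Maybe.map (λ a → σ (inj₂ a)) (b L₂ j))
    g-def : ∀ i → g L i ≡ (g L₁ i <∣> g L₂ i)

record IsTransition {k} (L : LIG k) (f : ℕ → Maybe (Fin k)) : Set where
  field
    nonempty : ∃[ i ] ∃[ j ] (f i ≡ just j)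
    dom⊆     : ∀ i j → f i ≡ just j → ∃[ j′ ] (g L i ≡ just j′)
    closed   : ∀ i j → g L i ≡ just j → (∃[ i′ ] (f i′ ≡ just j)) → ∃[ j′ ] (f i ≡ just j′)

record IsMf {k} (f : ℕ → Maybe (Fin k)) (M : LIG k) : Set where
  field
    r-dom₁ : ∀ i → r M i ≡ nothing → f i ≡ nothing
    r-dom₂ : ∀ i → f i ≡ nothing → r M i ≡ nothing
    r-inj  : ∀ i i′ v → r M i ≡ just v → r M i′ ≡ just v → i ≡ i′
    r-surj : ∀ v → ∃[ i ] (r M i ≡ just v)
    b-dom₁ : ∀ j → b M j ≡ nothing → ¬ (∃[ i ] (f i ≡ just j))
    b-dom₂ : ∀ j → ¬ (∃[ i ] (f i ≡ just j)) → b M j ≡ nothing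
    b-inj  : ∀ j j′ e → b M j ≡ just e → b M j′ ≡ just e → j ≡ j′
    b-surj : ∀ e → ∃[ j ] (b M j ≡ just e)
    g-def  : ∀ i → g M i ≡ f i
    E-def₁ : ∀ e v → E M e v ≡ true → ∃[ i ] ∃[ j ] (r M i ≡ just v × f i ≡ just j × b M j ≡ just e)
    E-def₂ : ∀ i j e v → r M i ≡ just v → f i ≡ just j → b M j ≡ just e → E M e v ≡ true

-- the blue labels img(g) ∩ img(f) ∩ dom(b)
-- (dom f ⊆ dom g ⊆ {0,…,bound-1}, so the bound of L also bounds dom f)
transLabels : ∀ {k} → LIG k → (ℕ → Maybe (Fin k)) → Fin k → Bool
transLabels L f j = imgᵇ (g L) (bound L) j ∧ imgᵇ f (bound L) j ∧ is-just (b L j)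

transPrime : ∀ {k} → LIG k → (ℕ → Maybe (Fin k)) → LIG k
transPrime L f = removeBlue L (transLabels L f)

data GLI (k : ℕ) : ℕ → LIG k → Set where
  gli-base  : ∀ L → RealGuards L → AllLabelled L → GLI k 0 L
  gli-suc   : ∀ {i L} → GLI k i L → GLI k (suc i) L
  gli-glue  : ∀ {i₁ i₂ L₁ L₂ L} → GLI k i₁ L₁ → GLI k i₂ L₂ →
              Compatible (g L₁) (g L₂) → IsGlue L₁ L₂ L → GLI k (i₁ ⊔ i₂) L
  gli-trans : ∀ {i L f M L[f]} → GLI k i L → IsTransition L f →
              IsMf f M → IsGlue M (transPrime L f) L[f] →
              GLI k (i + countB (transLabels L f)) L[f]
  gli-remR  : ∀ {i L} (X : ℕ → Bool) →
              (∀ n → X n ≡ true → ∃[ v ] (r L n ≡ just v)) →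
              GLI k i L → GLI k i (removeRed L X)
  gli-remB  : ∀ {i L} (X : Fin k → Bool) →
              (∀ j → X j ≡ true → ∃[ e ] (b L j ≡ just e) × ¬ (∃[ n ] (g L n ≡ just j))) →
              GLI k i L → GLI k (i + countB X) (removeBlue L X)

-- PathLen par s ℓ : the path from s to its root has ℓ nodes (ℓ = |P(s)|)
data PathLen {n : ℕ} (par : Fin n → Maybe (Fin n)) : Fin n → ℕ → Set where
  root : ∀ {s} → par s ≡ nothing → PathLen par s 1
  up   : ∀ {s t ℓ} → par s ≡ just t → PathLen par t ℓ → PathLen par s (suc ℓ)

data OnPath {n : ℕ} (par : Fin n → Maybe (Fin n)) : Fin n → Fin n → Set where
  here  : ∀ {s} → OnPath par s s
  there : ∀ {s t p} → par s ≡ just t → OnPath par t p → OnPath par s p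

record RootedForest : Set where
  field
    size   : ℕ
    parent : Fin size → Maybe (Fin size)
    -- every node reaches a root (so the parent relation is acyclic)
    reachesRoot : ∀ s → ∃[ ℓ ] (PathLen parent s ℓ)

open RootedForest public

Vtx : RootedForest → Set
Vtx F = Fin (size F)

P∋ : (F : RootedForest) → Vtx F → Vtx F → Set
P∋ F s p = OnPath (parent F) s p

LeF : (F : RootedForest) → Vtx F → Vtx F → Set
LeF F x y = P∋ F y x

HeightAtMost : RootedForest → ℕ → Set
HeightAtMost F d = ∀ s ℓ → PathLen (parent F) s ℓ → ℓ ≤ d

IsLcv : (F : RootedForest) → Vtx F → Vtx F → Vtx F → Set
IsLcv F s t u = P∋ F s u × P∋ F t u × (∀ w → P∋ F s w → P∋ F t w → LeF F w u)

InImgB : ∀ {k} (L : LIG k) → Fin (nB L) → Set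
InImgB L e = ∃[ j ] (b L j ≡ just e)

IsBijToUnlabelled : ∀ {k} (L : LIG k) (F : RootedForest) → (Vtx F → Fin (nB L)) → Set
IsBijToUnlabelled L F Γ =
  (∀ s t → Γ s ≡ Γ t → s ≡ t) ×
  (∀ s → ¬ InImgB L (Γ s)) ×
  (∀ e → ¬ InImgB L e → ∃[ s ] (Γ s ≡ e))

InΓ̃ : ∀ {k} (L : LIG k) (F : RootedForest) → (Vtx F → Fin (nB L)) → Vtx F → Fin (nR L) → Set
InΓ̃ L F Γ t v = (E L (Γ t) v ≡ true) × ¬ (∃[ i ] (r L i ≡ just v))

Separating : ∀ {k} (L : LIG k) (F : RootedForest) → (Vtx F → Fin (nB L)) → Set
Separating L F Γ = ∀ s t v → InΓ̃ L F Γ s v → InΓ̃ L F Γ t v →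
  (∃[ j ] ∃[ e ] (b L j ≡ just e × E L e v ≡ true)) ⊎
  (∃[ u ] (IsLcv F s t u × ∃[ p ] (P∋ F u p × InΓ̃ L F Γ p v)))

module Submission where

-- By induction on the derivation of L ∈ GLI_k^d, together with the invariant that L has real guards.
-- A base graph has all blue vertices labelled, so the empty forest works. Glueing takes the disjoint
-- union of the two forests: an unlabelled blue or red vertex of the glued graph has exactly one
-- preimage, so Γ and separation transfer side by side. Removing a blue label (directly, or inside a
-- transition) unlabels at most one blue vertex u, which becomes a new root above the whole forest;
-- this costs one level, and a red vertex adjacent to u is separated because the new root lies above
-- every lcv. Removing red labels is harmless: by real guards a labelled red vertex has a labelled
-- blue neighbour.

open import Defs
open import Data.Nat using (ℕ; zero; suc; _+_; _≤_; _⊔_; z≤n; s≤s; _<?_)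
open import Data.Nat.Properties using (≤-trans; ≤-reflexive; n≤1+n; m≤m⊔n; m≤n⊔m; +-assoc; +-comm; ≮⇒≥)
open import Data.Fin using (Fin; zero; suc; _↑ˡ_; _↑ʳ_; splitAt; join; toℕ; fromℕ<)
import Data.Fin as Fin
open import Data.Fin.Properties
  using (splitAt-↑ˡ; splitAt-↑ʳ; splitAt⁻¹-↑ˡ; splitAt⁻¹-↑ʳ; splitAt-join; join-splitAt;
         ↑ˡ-injective; ↑ʳ-injective; suc-injective; any?; toℕ-fromℕ<)
open import Data.Bool using (Bool; true; false; if_then_else_; _∧_)
open import Data.Maybe using (Maybe; just; nothing; maybe′; _<∣>_)
import Data.Maybe as Maybe
open import Data.Maybe.Properties using (just-injective)
import Data.Maybe.Properties as Maybeₚ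
open import Data.Product using (Σ; ∃-syntax; _×_; _,_; proj₁; proj₂)
import Data.Product as Product
open import Data.Sum using (_⊎_; inj₁; inj₂; [_,_]′)
import Data.Sum as Sum
open import Data.Sum.Properties using (inj₁-injective; inj₂-injective)
open import Data.Empty using (⊥-elim)
open import Function using (_∘_; id)
open import Level using (0ℓ)
open import Relation.Binary.PropositionalEquality
open import Relation.Nullary using (Dec; yes; no)
open import Relation.Nullary.Decidable using (_⊎-dec_)
open import Relation.Unary using (Pred; Decidable; Universal; _∈_; _∉_; _⊆_; _≐_; _∪_; ∅)
open import Relation.Unary.Properties using (_∪?_; ∅?; ≐-sym; ≐-trans)

module _ {n : ℕ} {par : Fin n → Maybe (Fin n)} where

  OnPath-parent : ∀ {s t w} → par s ≡ just t → OnPath par s w → w ≡ s ⊎ OnPath par t w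
  OnPath-parent _ here = inj₁ refl
  OnPath-parent p (there q o) with trans (sym q) p
  ... | refl = inj₂ o

  OnPath-root : ∀ {s w} → par s ≡ nothing → OnPath par s w → w ≡ s
  OnPath-root _ here = refl
  OnPath-root p (there q _) with trans (sym p) q
  ... | ()

  OnPath? : ∀ {t ℓ} → PathLen par t ℓ → Decidable (OnPath par t)
  OnPath? {t} pl w with w Fin.≟ t
  ... | yes refl = yes here
  OnPath? (root p) w | no w≢t = no (w≢t ∘ OnPath-root p)
  OnPath? (up p pl) w | no w≢t with OnPath? pl w
  ... | yes o = yes (there p o)
  ... | no ¬o = no λ o → [ w≢t , ¬o ]′ (OnPath-parent p o)

module _ (F : RootedForest) where

  -- The lcv is the first node on the path up from s that lies on the path from t.
  private
    lcv-upwards : ∀ {s ℓ t c} → PathLen (parent F) s ℓ → P∋ F s c → P∋ F t c → ∃[ u ] IsLcv F s t u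
    lcv-upwards {s} {t = t} pl sc tc with OnPath? (proj₂ (reachesRoot F t)) s
    ... | yes ts = s , here , ts , λ _ sw _ → sw
    lcv-upwards {t = t} (root p) sc tc | no ¬ts = ⊥-elim (¬ts (subst (P∋ F t) (OnPath-root p sc) tc))
    lcv-upwards {s} {t = t} (up p pl) sc tc | no ¬ts with OnPath-parent p sc
    ... | inj₁ refl = ⊥-elim (¬ts tc)
    ... | inj₂ s₁c with lcv-upwards pl s₁c tc
    ...   | u , s₁u , tu , below-u = u , there p s₁u , tu , below-u′
      where
      below-u′ : ∀ w → P∋ F s w → P∋ F t w → LeF F w u
      below-u′ w sw tw = [ (λ { refl → ⊥-elim (¬ts tw) }) , (λ s₁w → below-u w s₁w tw) ]′ (OnPath-parent p sw)

  common-ancestor⇒lcv : ∀ {s t c} → P∋ F s c → P∋ F t c → ∃[ u ] IsLcv F s t u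
  common-ancestor⇒lcv {s} = lcv-upwards (proj₂ (reachesRoot F s))

record Embedding (F G : RootedForest) : Set where
  field
    embed           : Vtx F → Vtx G
    embed-injective : ∀ {a a′} → embed a ≡ embed a′ → a ≡ a′
    embed-P∋        : ∀ {s p} → P∋ F s p → P∋ G (embed s) (embed p)
    -- ancestors of an embedded node are embedded, except possibly nodes above the whole image
    P∋-embed        : ∀ {s w} → P∋ G (embed s) w →
                      (∃[ p ] (w ≡ embed p × P∋ F s p)) ⊎ (∀ u → P∋ G (embed u) w)

  embed-IsLcv : ∀ {s t u} → IsLcv F s t u → IsLcv G (embed s) (embed t) (embed u)
  embed-IsLcv {s} {t} {u} (su , tu , below-u) = embed-P∋ su , embed-P∋ tu , below
    where
    below : ∀ w → P∋ G (embed s) w → P∋ G (embed t) w → LeF G w (embed u)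
    below w sw tw with P∋-embed sw | P∋-embed tw
    ... | inj₂ above-image | _ = above-image u
    ... | inj₁ _ | inj₂ above-image = above-image u
    ... | inj₁ (p , refl , sp) | inj₁ (p′ , eq , tp′) with embed-injective eq
    ...   | refl = embed-P∋ (below-u p sp tp′)

open Embedding public

module ParentHom {n m : ℕ} (pF : Fin n → Maybe (Fin n)) (pG : Fin m → Maybe (Fin m))
                 (φ : Fin n → Fin m) (hom : ∀ s → pG (φ s) ≡ Maybe.map φ (pF s)) where

  parent-map : ∀ {s t} → pF s ≡ just t → pG (φ s) ≡ just (φ t)
  parent-map {s} q = trans (hom s) (cong (Maybe.map φ) q)

  root-map : ∀ {s} → pF s ≡ nothing → pG (φ s) ≡ nothing
  root-map {s} q = trans (hom s) (cong (Maybe.map φ) q)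

  parent-reflect : ∀ {s t} → pG (φ s) ≡ just t → ∃[ s₁ ] (pF s ≡ just s₁ × t ≡ φ s₁)
  parent-reflect {s} q with pF s | hom s
  ... | just s₁ | h = s₁ , refl , just-injective (trans (sym q) h)
  ... | nothing | h with trans (sym q) h
  ...   | ()

  root-reflect : ∀ {s} → pG (φ s) ≡ nothing → pF s ≡ nothing
  root-reflect {s} q with pF s | hom s
  ... | nothing | _ = refl
  ... | just _ | h with trans (sym q) h
  ...   | ()

  PathLen-map : ∀ {s ℓ} → PathLen pF s ℓ → PathLen pG (φ s) ℓ
  PathLen-map (root q)  = root (root-map q)
  PathLen-map (up q pl) = up (parent-map q) (PathLen-map pl)

  OnPath-map : ∀ {s p} → OnPath pF s p → OnPath pG (φ s) (φ p)
  OnPath-map here        = here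
  OnPath-map (there q o) = there (parent-map q) (OnPath-map o)

  PathLen-reflect : ∀ {x ℓ} → PathLen pG x ℓ → ∀ s → x ≡ φ s → PathLen pF s ℓ
  PathLen-reflect (root q) s refl = root (root-reflect q)
  PathLen-reflect (up q pl) s refl with parent-reflect q
  ... | s₁ , q′ , refl = up q′ (PathLen-reflect pl s₁ refl)

  OnPath-reflect : ∀ {x w} → OnPath pG x w → ∀ s → x ≡ φ s → ∃[ p ] (w ≡ φ p × OnPath pF s p)
  OnPath-reflect here s eq = s , eq , here
  OnPath-reflect (there q o) s refl with parent-reflect q
  ... | s₁ , q′ , refl = Product.map₂ (Product.map₂ (there q′)) (OnPath-reflect o s₁ refl)

hom-embedding : ∀ {F G : RootedForest} (φ : Vtx F → Vtx G) → (∀ {a a′} → φ a ≡ φ a′ → a ≡ a′) →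
                (∀ s → parent G (φ s) ≡ Maybe.map φ (parent F s)) → Embedding F G
hom-embedding {F} {G} φ φ-injective hom = record
  { embed           = φ
  ; embed-injective = φ-injective
  ; embed-P∋        = OnPath-map
  ; P∋-embed        = λ {s} sw → inj₁ (OnPath-reflect sw s refl) }
  where open ParentHom (parent F) (parent G) φ hom

⊎-parent : ∀ {n₁ n₂} → (Fin n₁ → Maybe (Fin n₁)) → (Fin n₂ → Maybe (Fin n₂)) →
           Fin (n₁ + n₂) → Maybe (Fin (n₁ + n₂))
⊎-parent {n₁} {n₂} p₁ p₂ = [ Maybe.map (_↑ˡ n₂) ∘ p₁ , Maybe.map (n₁ ↑ʳ_) ∘ p₂ ]′ ∘ splitAt n₁

module _ {n₁ n₂} (p₁ : Fin n₁ → Maybe (Fin n₁)) (p₂ : Fin n₂ → Maybe (Fin n₂)) where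

  ⊎-parent-↑ˡ : ∀ a → ⊎-parent p₁ p₂ (a ↑ˡ n₂) ≡ Maybe.map (_↑ˡ n₂) (p₁ a)
  ⊎-parent-↑ˡ a rewrite splitAt-↑ˡ n₁ a n₂ = refl

  ⊎-parent-↑ʳ : ∀ c → ⊎-parent p₁ p₂ (n₁ ↑ʳ c) ≡ Maybe.map (n₁ ↑ʳ_) (p₂ c)
  ⊎-parent-↑ʳ c rewrite splitAt-↑ʳ n₁ n₂ c = refl

data Split (n₁ n₂ : ℕ) : Fin (n₁ + n₂) → Set where
  left  : ∀ a → Split n₁ n₂ (a ↑ˡ n₂)
  right : ∀ c → Split n₁ n₂ (n₁ ↑ʳ c)

split : ∀ n₁ n₂ x → Split n₁ n₂ x
split n₁ n₂ x with splitAt n₁ x in eq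
... | inj₁ a = subst (Split n₁ n₂) (splitAt⁻¹-↑ˡ eq) (left a)
... | inj₂ c = subst (Split n₁ n₂) (splitAt⁻¹-↑ʳ eq) (right c)

_⊎ᶠ_ : RootedForest → RootedForest → RootedForest
F₁ ⊎ᶠ F₂ = record
  { size        = size F₁ + size F₂
  ; parent      = ⊎-parent (parent F₁) (parent F₂)
  ; reachesRoot = reaches }
  where
  open ParentHom using (PathLen-map)
  reaches : ∀ x → ∃[ ℓ ] PathLen (⊎-parent (parent F₁) (parent F₂)) x ℓ
  reaches x with split (size F₁) (size F₂) x
  ... | left a  = Product.map₂ (PathLen-map (parent F₁) _ _ (⊎-parent-↑ˡ (parent F₁) (parent F₂))) (reachesRoot F₁ a)
  ... | right c = Product.map₂ (PathLen-map (parent F₂) _ _ (⊎-parent-↑ʳ (parent F₁) (parent F₂))) (reachesRoot F₂ c)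

module _ (F₁ F₂ : RootedForest) where

  private
    n₁ n₂ : ℕ
    n₁ = size F₁
    n₂ = size F₂

    homˡ : ∀ a → parent (F₁ ⊎ᶠ F₂) (a ↑ˡ n₂) ≡ Maybe.map (_↑ˡ n₂) (parent F₁ a)
    homˡ = ⊎-parent-↑ˡ (parent F₁) (parent F₂)

    homʳ : ∀ c → parent (F₁ ⊎ᶠ F₂) (n₁ ↑ʳ c) ≡ Maybe.map (n₁ ↑ʳ_) (parent F₂ c)
    homʳ = ⊎-parent-↑ʳ (parent F₁) (parent F₂)

    module Hˡ = ParentHom (parent F₁) (parent (F₁ ⊎ᶠ F₂)) (_↑ˡ n₂) homˡ
    module Hʳ = ParentHom (parent F₂) (parent (F₁ ⊎ᶠ F₂)) (n₁ ↑ʳ_) homʳ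

  ↑ˡ-embedding : Embedding F₁ (F₁ ⊎ᶠ F₂)
  ↑ˡ-embedding = hom-embedding (_↑ˡ n₂) (↑ˡ-injective n₂ _ _) homˡ

  ↑ʳ-embedding : Embedding F₂ (F₁ ⊎ᶠ F₂)
  ↑ʳ-embedding = hom-embedding (n₁ ↑ʳ_) (↑ʳ-injective n₁ _ _) homʳ

  ⊎ᶠ-height : ∀ {d₁ d₂} → HeightAtMost F₁ d₁ → HeightAtMost F₂ d₂ →
              HeightAtMost (F₁ ⊎ᶠ F₂) (d₁ ⊔ d₂)
  ⊎ᶠ-height {d₁} {d₂} h₁ h₂ x ℓ pl with split n₁ n₂ x
  ... | left a  = ≤-trans (h₁ a ℓ (Hˡ.PathLen-reflect pl a refl)) (m≤m⊔n d₁ d₂)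
  ... | right c = ≤-trans (h₂ c ℓ (Hʳ.PathLen-reflect pl c refl)) (m≤n⊔m d₁ d₂)

-- The old roots become children of the new root zero.
addRoot-parent : ∀ {n} → (Fin n → Maybe (Fin n)) → Fin (suc n) → Maybe (Fin (suc n))
addRoot-parent p zero    = nothing
addRoot-parent p (suc s) = just (maybe′ suc zero (p s))

module _ (F : RootedForest) where

  private
    p : Fin (size F) → Maybe (Fin (size F))
    p = parent F

    p⁺ : Fin (suc (size F)) → Maybe (Fin (suc (size F)))
    p⁺ = addRoot-parent p

    p⁺-suc : ∀ {s m} → p s ≡ m → p⁺ (suc s) ≡ just (maybe′ suc zero m)
    p⁺-suc = cong (just ∘ maybe′ suc zero)

  PathLen-addRoot : ∀ {s ℓ} → PathLen p s ℓ → PathLen p⁺ (suc s) (suc ℓ)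
  PathLen-addRoot (root q)  = up (p⁺-suc q) (root refl)
  PathLen-addRoot (up q pl) = up (p⁺-suc q) (PathLen-addRoot pl)

  addRoot : RootedForest
  addRoot = record
    { size        = suc (size F)
    ; parent      = p⁺
    ; reachesRoot = λ { zero → 1 , root refl
                      ; (suc s) → Product.map suc PathLen-addRoot (reachesRoot F s) } }

  private
    PathLen-new-root : ∀ {ℓ} → PathLen p⁺ zero ℓ → ℓ ≡ 1
    PathLen-new-root (root _) = refl
    PathLen-new-root (up () _)

    PathLen-addRoot-reflect : ∀ {s ℓ} → PathLen p⁺ (suc s) ℓ → ∃[ ℓ′ ] (PathLen p s ℓ′ × ℓ ≡ suc ℓ′)
    PathLen-addRoot-reflect {s} (up refl pl) with p s in e
    ... | nothing = 1 , root e , cong suc (PathLen-new-root pl)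
    ... | just s₁ = Product.map suc (Product.map (up e) (cong suc)) (PathLen-addRoot-reflect pl)

    P∋-new-root : ∀ {s ℓ} → PathLen p s ℓ → P∋ addRoot (suc s) zero
    P∋-new-root (root q)  = there (p⁺-suc q) here
    P∋-new-root (up q pl) = there (p⁺-suc q) (P∋-new-root pl)

    P∋-addRoot : ∀ {s w} → P∋ F s w → P∋ addRoot (suc s) (suc w)
    P∋-addRoot here        = here
    P∋-addRoot (there q o) = there (p⁺-suc q) (P∋-addRoot o)

    P∋-addRoot-reflect : ∀ {s w} → P∋ addRoot (suc s) w → w ≡ zero ⊎ ∃[ w′ ] (w ≡ suc w′ × P∋ F s w′)
    P∋-addRoot-reflect here = inj₂ (_ , refl , here)
    P∋-addRoot-reflect {s} (there refl o) with p s in e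
    ... | nothing = inj₁ (OnPath-root refl o)
    ... | just s₁ = Sum.map₂ (Product.map₂ (Product.map₂ (there e))) (P∋-addRoot-reflect o)

  new-root-above : ∀ x → P∋ addRoot x zero
  new-root-above zero    = here
  new-root-above (suc s) = P∋-new-root (proj₂ (reachesRoot F s))

  suc-embedding : Embedding F addRoot
  suc-embedding = record
    { embed           = suc
    ; embed-injective = suc-injective
    ; embed-P∋        = P∋-addRoot
    ; P∋-embed        = [ (λ { refl → inj₂ (new-root-above ∘ suc) }) , inj₁ ]′ ∘ P∋-addRoot-reflect }

  addRoot-height : ∀ {d} → HeightAtMost F d → HeightAtMost addRoot (suc d)
  addRoot-height h zero ℓ pl rewrite PathLen-new-root pl = s≤s z≤n
  addRoot-height h (suc s) ℓ pl with PathLen-addRoot-reflect pl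
  ... | ℓ′ , pl′ , refl = s≤s (h s ℓ′ pl′)

private
  variable
    nr nb d : ℕ
    Edge : Fin nb → Fin nr → Bool
    R : Pred (Fin nr) 0ℓ
    B B′ : Pred (Fin nb) 0ℓ

UnlabelledNbr : ∀ {nr nb m} → (Fin nb → Fin nr → Bool) → Pred (Fin nr) 0ℓ →
                (Fin m → Fin nb) → Fin m → Fin nr → Set
UnlabelledNbr Edge R Γ t v = Edge (Γ t) v ≡ true × v ∉ R

Separated : (Fin nb → Fin nr → Bool) → Pred (Fin nr) 0ℓ → Pred (Fin nb) 0ℓ →
            (F : RootedForest) → (Vtx F → Fin nb) → Vtx F → Vtx F → Fin nr → Set
Separated Edge R B F Γ s t v =
  (∃[ e ] (e ∈ B × Edge e v ≡ true)) ⊎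
  (∃[ u ] (IsLcv F s t u × ∃[ p ] (P∋ F u p × UnlabelledNbr Edge R Γ p v)))

-- R and B play the roles of img(r) and img(b); label removal changes them while the graph stays fixed.
record Decomposition (Edge : Fin nb → Fin nr → Bool) (R : Pred (Fin nr) 0ℓ) (B : Pred (Fin nb) 0ℓ)
                     (d : ℕ) : Set where
  field
    forest       : RootedForest
    height       : HeightAtMost forest d
    Γ            : Vtx forest → Fin nb
    Γ-injective  : ∀ s t → Γ s ≡ Γ t → s ≡ t
    Γ-unlabelled : ∀ s → Γ s ∉ B
    Γ-onto       : ∀ e → e ∉ B → ∃[ s ] (Γ s ≡ e)
    separating   : ∀ s t v → UnlabelledNbr Edge R Γ s v → UnlabelledNbr Edge R Γ t v →
                   Separated Edge R B forest Γ s t v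

Decomposition-weaken : ∀ {d′} → d ≤ d′ → Decomposition Edge R B d → Decomposition Edge R B d′
Decomposition-weaken d≤d′ D = record
  { Decomposition D hiding (height)
  ; height = λ s ℓ pl → ≤-trans (height s ℓ pl) d≤d′ }
  where open Decomposition D

Decomposition-resp-≐ : B ≐ B′ → Decomposition Edge R B d → Decomposition Edge R B′ d
Decomposition-resp-≐ (B⊆B′ , B′⊆B) D = record
  { Decomposition D hiding (Γ-unlabelled; Γ-onto; separating)
  ; Γ-unlabelled = λ s → Γ-unlabelled s ∘ B′⊆B
  ; Γ-onto       = λ e e∉B′ → Γ-onto e (e∉B′ ∘ B⊆B′)
  ; separating   = λ s t v nbr-s nbr-t →
      Sum.map₁ (λ { (e , e∈B , Eev) → e , B⊆B′ e∈B , Eev }) (separating s t v nbr-s nbr-t) }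
  where open Decomposition D

Decomposition-of-labelled : Universal B → Decomposition Edge R B 0
Decomposition-of-labelled all-labelled = record
  { forest       = record { size = 0 ; parent = λ () ; reachesRoot = λ () }
  ; height       = λ ()
  ; Γ            = λ ()
  ; Γ-injective  = λ ()
  ; Γ-unlabelled = λ ()
  ; Γ-onto       = λ e e∉B → ⊥-elim (e∉B (all-labelled e))
  ; separating   = λ () }

-- Red labels matter only on vertices without a labelled blue neighbour, hence R′ is arbitrary.
Decomposition-relabel-red : ∀ {nr nb d} {Edge : Fin nb → Fin nr → Bool} {R R′ : Pred (Fin nr) 0ℓ}
  {B : Pred (Fin nb) 0ℓ} → Decidable R → (∀ {v} → v ∈ R → ∃[ e ] (e ∈ B × Edge e v ≡ true)) →
  Decomposition Edge R B d → Decomposition Edge R′ B d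
Decomposition-relabel-red {Edge = Edge} {R} {R′} {B} R? guarded D = record
  { Decomposition D hiding (separating)
  ; separating = separating′ }
  where
  open Decomposition D
  separating′ : ∀ s t v → UnlabelledNbr Edge R′ Γ s v → UnlabelledNbr Edge R′ Γ t v →
                Separated Edge R′ B forest Γ s t v
  separating′ s t v (Es , v∉R′) (Et , _) with R? v
  ... | yes v∈R = inj₁ (guarded v∈R)
  ... | no v∉R  = Sum.map₂ (λ { (u , lcv , p , p≤u , Ep , _) → u , lcv , p , p≤u , Ep , v∉R′ })
                           (separating s t v (Es , v∉R) (Et , v∉R))

-- Unlabelling u costs one level: u becomes Γ of a new root, which lies above every lcv.
Decomposition-addRoot : ∀ {nr nb d} {Edge : Fin nb → Fin nr → Bool} {R : Pred (Fin nr) 0ℓ}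
  {B B′ : Pred (Fin nb) 0ℓ} {u} →
  u ∈ B → B′ ⊆ B → (∀ {e} → e ∈ B → e ≢ u → e ∈ B′) → u ∉ B′ →
  Decomposition Edge R B d → Decomposition Edge R B′ (suc d)
Decomposition-addRoot {nb = nb} {Edge = Edge} {R} {B} {B′} {u} u∈B B′⊆B B∖u⊆B′ u∉B′ D = record
  { forest       = F⁺
  ; height       = addRoot-height forest height
  ; Γ            = Γ⁺
  ; Γ-injective  = Γ⁺-injective
  ; Γ-unlabelled = Γ⁺-unlabelled
  ; Γ-onto       = Γ⁺-onto
  ; separating   = separating⁺ }
  where
  open Decomposition D
  F⁺ : RootedForest
  F⁺ = addRoot forest

  ι : Embedding forest F⁺
  ι = suc-embedding forest

  Γ⁺ : Vtx F⁺ → Fin nb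
  Γ⁺ zero    = u
  Γ⁺ (suc s) = Γ s

  Γ⁺-injective : ∀ s t → Γ⁺ s ≡ Γ⁺ t → s ≡ t
  Γ⁺-injective zero    zero    _  = refl
  Γ⁺-injective zero    (suc t) eq = ⊥-elim (Γ-unlabelled t (subst (_∈ B) eq u∈B))
  Γ⁺-injective (suc s) zero    eq = ⊥-elim (Γ-unlabelled s (subst (_∈ B) (sym eq) u∈B))
  Γ⁺-injective (suc s) (suc t) eq = cong suc (Γ-injective s t eq)

  Γ⁺-unlabelled : ∀ s → Γ⁺ s ∉ B′
  Γ⁺-unlabelled zero    = u∉B′
  Γ⁺-unlabelled (suc s) = Γ-unlabelled s ∘ B′⊆B

  Γ⁺-onto : ∀ e → e ∉ B′ → ∃[ s ] (Γ⁺ s ≡ e)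
  Γ⁺-onto e e∉B′ with e Fin.≟ u
  ... | yes refl = zero , refl
  ... | no e≢u with Γ-onto e (λ e∈B → e∉B′ (B∖u⊆B′ e∈B e≢u))
  ...   | s , Γs≡e = suc s , Γs≡e

  via-new-root : ∀ s t {v} → Edge u v ≡ true → v ∉ R → Separated Edge R B′ F⁺ Γ⁺ s t v
  via-new-root s t Euv v∉R with common-ancestor⇒lcv F⁺ (new-root-above forest s) (new-root-above forest t)
  ... | w , lcv = inj₂ (w , lcv , zero , new-root-above forest w , Euv , v∉R)

  separating⁺ : ∀ s t v → UnlabelledNbr Edge R Γ⁺ s v → UnlabelledNbr Edge R Γ⁺ t v →
                Separated Edge R B′ F⁺ Γ⁺ s t v
  separating⁺ zero    t       v (Euv , v∉R) _           = via-new-root zero t Euv v∉R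
  separating⁺ (suc s) zero    v _           (Euv , v∉R) = via-new-root (suc s) zero Euv v∉R
  separating⁺ (suc s) (suc t) v nbr-s nbr-t with separating s t v nbr-s nbr-t
  ... | inj₂ (w , lcv , p , p≤w , nbr-p) =
          inj₂ (suc w , embed-IsLcv ι lcv , suc p , embed-P∋ ι p≤w , nbr-p)
  ... | inj₁ (e , e∈B , Eev) with e Fin.≟ u
  ...   | yes refl = via-new-root (suc s) (suc t) Eev (proj₂ nbr-s)
  ...   | no e≢u   = inj₁ (e , B∖u⊆B′ e∈B e≢u , Eev)

Decomposition-unlabel : ∀ {u} → u ∈ B → B′ ⊆ B → (∀ {e} → e ∈ B → e ≢ u → e ∈ B′) → Dec (u ∈ B′) →
  Decomposition Edge R B d → Decomposition Edge R B′ (suc d)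
Decomposition-unlabel u∈B B′⊆B B∖u⊆B′ (no u∉B′) = Decomposition-addRoot u∈B B′⊆B B∖u⊆B′ u∉B′
Decomposition-unlabel {B = B} {B′ = B′} {u = u} u∈B B′⊆B B∖u⊆B′ (yes u∈B′) =
  Decomposition-weaken (n≤1+n _) ∘ Decomposition-resp-≐ (B⊆B′ , B′⊆B)
  where
  B⊆B′ : B ⊆ B′
  B⊆B′ {e} e∈B with e Fin.≟ u
  ... | yes refl = u∈B′
  ... | no e≢u   = B∖u⊆B′ e∈B e≢u

Just : {A : Set} → Maybe A → Pred A 0ℓ
Just m a = m ≡ just a

Img : {I A : Set} → (I → Maybe A) → Pred A 0ℓ
Img f a = ∃[ i ] Just (f i) a

Just? : ∀ {n} (m : Maybe (Fin n)) → Decidable (Just m)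
Just? m e = Maybeₚ.≡-dec Fin._≟_ m (just e)

Img? : ∀ {k n} (f : Fin k → Maybe (Fin n)) → Decidable (Img f)
Img? f e = any? (λ i → Just? (f i) e)

forget : ∀ {k} {A : Set} → (Fin k → Bool) → (Fin k → Maybe A) → Fin k → Maybe A
forget X f j = if X j then nothing else f j

module _ {A : Set} {P Q S : Pred A 0ℓ} where

  ∪-swapʳ : (P ∪ Q) ∪ S ≐ (P ∪ S) ∪ Q
  ∪-swapʳ = swap {P} {Q} {S} , swap {P} {S} {Q}
    where
    swap : ∀ {P Q S : Pred A 0ℓ} → (P ∪ Q) ∪ S ⊆ (P ∪ S) ∪ Q
    swap (inj₁ (inj₁ p)) = inj₁ (inj₁ p)
    swap (inj₁ (inj₂ q)) = inj₂ q
    swap (inj₂ s)        = inj₁ (inj₂ s)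

module _ {A : Set} {P : Pred A 0ℓ} where

  ∅-∪ : ∅ ∪ P ≐ P
  ∅-∪ = (λ { (inj₂ p) → p }) , inj₂

  ∪-Img-suc : ∀ {k} {f : Fin (suc k) → Maybe A} → P ∪ Img f ≐ (P ∪ Img (f ∘ suc)) ∪ Just (f zero)
  ∪-Img-suc = (λ { (inj₁ p)            → inj₁ (inj₁ p)
                 ; (inj₂ (zero , eq))  → inj₂ eq
                 ; (inj₂ (suc i , eq)) → inj₁ (inj₂ (i , eq)) })
            , (λ { (inj₁ (inj₁ p))        → inj₁ p
                 ; (inj₁ (inj₂ (i , eq))) → inj₂ (suc i , eq)
                 ; (inj₂ eq)              → inj₂ (zero , eq) })

  ∪-Img-zero : ∀ {f g : Fin 0 → Maybe A} → P ∪ Img f ⊆ P ∪ Img g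
  ∪-Img-zero (inj₁ p) = inj₁ p

Decomposition-forget-label : ∀ {Base : Pred (Fin nb) 0ℓ} (x : Bool) (m : Maybe (Fin nb)) → Decidable Base →
  Decomposition Edge R (Base ∪ Just m) d →
  Decomposition Edge R (Base ∪ Just (if x then nothing else m)) ((if x then 1 else 0) + d)
Decomposition-forget-label false m        _     = id
Decomposition-forget-label true  nothing  _     = Decomposition-weaken (n≤1+n _)
Decomposition-forget-label {Base = Base} true (just u) Base? =
  Decomposition-unlabel (inj₂ refl) shrink keep (Base? u ⊎-dec no λ ())
  where
  shrink : Base ∪ Just nothing ⊆ Base ∪ Just (just u)
  shrink (inj₁ x) = inj₁ x
  keep : ∀ {e} → e ∈ Base ∪ Just (just u) → e ≢ u → e ∈ Base ∪ Just nothing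
  keep (inj₁ x)    _   = inj₁ x
  keep (inj₂ refl) e≢u = ⊥-elim (e≢u refl)

-- Base stands for the labels outside the range of f; generalizing over it lets the induction drop f zero.
Decomposition-forget-labels : ∀ {k} {Base : Pred (Fin nb) 0ℓ} (X : Fin k → Bool) (f : Fin k → Maybe (Fin nb)) →
  Decidable Base → Decomposition Edge R (Base ∪ Img f) d →
  Decomposition Edge R (Base ∪ Img (forget X f)) (countB X + d)
Decomposition-forget-labels {k = zero} {Base} X f _ =
  Decomposition-resp-≐ (∪-Img-zero {P = Base} {g = forget X f} , ∪-Img-zero {P = Base} {f = forget X f})
Decomposition-forget-labels {Edge = Edge} {R = R} {d = d} {k = suc k} {Base} X f Base? D =
  Decomposition-weaken (≤-reflexive (sym (+-assoc (if X zero then 1 else 0) (countB (X ∘ suc)) d)))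
    (Decomposition-resp-≐ (≐-sym ∪-Img-suc) head-forgotten)
  where
  tail-forgotten : Decomposition Edge R ((Base ∪ Just (f zero)) ∪ Img (forget (X ∘ suc) (f ∘ suc)))
                     (countB (X ∘ suc) + d)
  tail-forgotten = Decomposition-forget-labels (X ∘ suc) (f ∘ suc) (Base? ∪? Just? (f zero))
                     (Decomposition-resp-≐ (≐-trans ∪-Img-suc ∪-swapʳ) D)
  head-forgotten : Decomposition Edge R ((Base ∪ Img (forget (X ∘ suc) (f ∘ suc))) ∪ Just (forget X f zero))
                     ((if X zero then 1 else 0) + (countB (X ∘ suc) + d))
  head-forgotten = Decomposition-forget-label (X zero) (f zero) (Base? ∪? Img? (forget (X ∘ suc) (f ∘ suc)))
                     (Decomposition-resp-≐ ∪-swapʳ tail-forgotten)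

DecompositionOf : ∀ {k} → LIG k → ℕ → Set
DecompositionOf L d = Decomposition (E L) (Img (r L)) (Img (b L)) d

GuardAt : ∀ {k} → LIG k → ℕ → Fin k → Set
GuardAt L i j = ∃[ e ] (b L j ≡ just e × ∃[ v ] (r L i ≡ just v × E L e v ≡ true))

Img?-bounded : ∀ {n} (h : ℕ → Maybe (Fin n)) (N : ℕ) → (∀ i → N ≤ i → h i ≡ nothing) → Decidable (Img h)
Img?-bounded h N vanishes v with any? (λ (i : Fin N) → Just? (h (toℕ i)) v)
... | yes (i , hi) = yes (toℕ i , hi)
... | no none      = no λ { (i , hi) → none (below i hi) }
  where
  below : ∀ i → h i ≡ just v → ∃[ i′ ] Just (h (toℕ i′)) v
  below i hi with i <? N
  ... | yes i<N = fromℕ< i<N , subst (λ n → Just (h n) v) (sym (toℕ-fromℕ< i<N)) hi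
  ... | no i≮N with trans (sym (vanishes i (≮⇒≥ i≮N))) hi
  ...   | ()

module _ {k} (L : LIG k) where

  Img-r? : Decidable (Img (r L))
  Img-r? = Img?-bounded (r L) (bound L) (r-fin L)

  labelled-red-guarded : RealGuards L → ∀ {v} → v ∈ Img (r L) → ∃[ e ] (e ∈ Img (b L) × E L e v ≡ true)
  labelled-red-guarded guards {v} (i , ri) with g L i in gi
  ... | nothing with trans (sym (dom-g₂ L i gi)) ri
  ...   | ()
  labelled-red-guarded guards {v} (i , ri) | just j with guards i j gi
  ... | e , bj , w , ri′ , Eew with trans (sym ri) ri′
  ...   | refl = e , (j , bj) , Eew

  removeRed-decomposition : ∀ {d} → RealGuards L → (X : ℕ → Bool) →
                            DecompositionOf L d → DecompositionOf (removeRed L X) d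
  removeRed-decomposition guards X = Decomposition-relabel-red Img-r? (labelled-red-guarded guards)

  removeBlue-decomposition : ∀ {d} (X : Fin k → Bool) →
                             DecompositionOf L d → DecompositionOf (removeBlue L X) (d + countB X)
  removeBlue-decomposition {d} X =
    Decomposition-weaken (≤-reflexive (+-comm (countB X) d))
    ∘ Decomposition-resp-≐ (∅-∪ {P = Img (forget X (b L))})
    ∘ Decomposition-forget-labels X (b L) ∅?
    ∘ Decomposition-resp-≐ (≐-sym (∅-∪ {P = Img (b L)}))

  removeRed-guards : RealGuards L → (X : ℕ → Bool) → RealGuards (removeRed L X)
  removeRed-guards guards X i j gi with X i
  ... | false = guards i j gi

  GuardAt-removeBlue : ∀ {i j} (X : Fin k → Bool) → GuardAt L i j → X j ≡ false → GuardAt (removeBlue L X) i j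
  GuardAt-removeBlue X (e , bj , rest) Xj rewrite Xj = e , bj , rest

  removeBlue-guards : RealGuards L → (X : Fin k → Bool) → (∀ {i j} → g L i ≡ just j → X j ≡ false) →
                      RealGuards (removeBlue L X)
  removeBlue-guards guards X kept i j gi = GuardAt-removeBlue X (guards i j gi) (kept gi)

EqClo-≡⊎both : ∀ {A : Set} {Rel : A → A → Set} {P : Pred A 0ℓ} → (∀ {x y} → Rel x y → x ∈ P × y ∈ P) →
               ∀ {x y} → EqClo Rel x y → x ≡ y ⊎ (x ∈ P × y ∈ P)
EqClo-≡⊎both both (base xy) = inj₂ (both xy)
EqClo-≡⊎both both refl′     = inj₁ refl
EqClo-≡⊎both both (sym′ q)  = Sum.map sym Product.swap (EqClo-≡⊎both both q)
EqClo-≡⊎both both (trans′ q₁ q₂) with EqClo-≡⊎both both q₁ | EqClo-≡⊎both both q₂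
... | inj₁ refl        | eq₂              = eq₂
... | inj₂ x∈P,y∈P     | inj₁ refl        = inj₂ x∈P,y∈P
... | inj₂ (x∈P , _)   | inj₂ (_ , z∈P)   = inj₂ (x∈P , z∈P)

EqClo-injective-outside : ∀ {A B : Set} {Rel : A → A → Set} {P : Pred A 0ℓ} {f : A → B} →
  (∀ {x y} → Rel x y → x ∈ P × y ∈ P) → (∀ {x y} → f x ≡ f y → EqClo Rel x y) →
  ∀ {x y} → f x ≡ f y → x ∉ P → x ≡ y
EqClo-injective-outside both ker fx≡fy x∉P = [ id , (⊥-elim ∘ x∉P ∘ proj₁) ]′ (EqClo-≡⊎both both (ker fx≡fy))

module _ {A₁ A₂ A : Set} (f₁ : A₁ → A) (f₂ : A₂ → A) where

  <∣>-left : ∀ {m₁} m₂ {a} → m₁ ≡ just a → Maybe.map f₁ m₁ <∣> Maybe.map f₂ m₂ ≡ just (f₁ a)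
  <∣>-left _ refl = refl

  <∣>-right : ∀ m₁ {m₂ c} → m₂ ≡ just c → (∀ {a} → m₁ ≡ just a → f₁ a ≡ f₂ c) →
              Maybe.map f₁ m₁ <∣> Maybe.map f₂ m₂ ≡ just (f₂ c)
  <∣>-right nothing  refl _    = refl
  <∣>-right (just a) refl same = cong just (same refl)

  <∣>-inv : ∀ m₁ m₂ {x} → Maybe.map f₁ m₁ <∣> Maybe.map f₂ m₂ ≡ just x →
            (∃[ a ] (m₁ ≡ just a × f₁ a ≡ x)) ⊎ (∃[ c ] (m₂ ≡ just c × f₂ c ≡ x))
  <∣>-inv (just a) _        eq = inj₁ (a , refl , just-injective eq)
  <∣>-inv nothing  (just c) eq = inj₂ (c , refl , just-injective eq)

⊎-map-injective : ∀ {A B C D : Set} {f : A → C} {g : B → D} →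
  (∀ {a a′} → f a ≡ f a′ → a ≡ a′) → (∀ {b b′} → g b ≡ g b′ → b ≡ b′) →
  ∀ {x y} → Sum.map f g x ≡ Sum.map f g y → x ≡ y
⊎-map-injective f-inj g-inj {inj₁ a} {inj₁ a′} eq = cong inj₁ (f-inj (inj₁-injective eq))
⊎-map-injective f-inj g-inj {inj₂ b} {inj₂ b′} eq = cong inj₂ (g-inj (inj₂-injective eq))

splitAt-injective : ∀ m {n} {x y : Fin (m + n)} → splitAt m x ≡ splitAt m y → x ≡ y
splitAt-injective m {n} {x} {y} eq = begin
  x                      ≡⟨ sym (join-splitAt m n x) ⟩
  join m n (splitAt m x) ≡⟨ cong (join m n) eq ⟩
  join m n (splitAt m y) ≡⟨ join-splitAt m n y ⟩
  y                      ∎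
  where open ≡-Reasoning

separated-embed : ∀ {nr nb nr′ nb′ d} {Edge : Fin nb → Fin nr → Bool} {R : Pred (Fin nr) 0ℓ} {B : Pred (Fin nb) 0ℓ}
  {Edge′ : Fin nb′ → Fin nr′ → Bool} {R′ : Pred (Fin nr′) 0ℓ} {B′ : Pred (Fin nb′) 0ℓ} {F′ : RootedForest}
  {Γ′ : Vtx F′ → Fin nb′} (D : Decomposition Edge R B d) (ι : Embedding (Decomposition.forest D) F′)
  (σ : Fin nb → Fin nb′) (ρ : Fin nr → Fin nr′) →
  (∀ a → Γ′ (embed ι a) ≡ σ (Decomposition.Γ D a)) →
  (∀ {e w} → Edge e w ≡ true → Edge′ (σ e) (ρ w) ≡ true) → (∀ {e} → e ∈ B → σ e ∈ B′) →
  ∀ {a a′ w v} → UnlabelledNbr Edge R (Decomposition.Γ D) a w → UnlabelledNbr Edge R (Decomposition.Γ D) a′ w →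
  ρ w ≡ v → v ∉ R′ → Separated Edge′ R′ B′ F′ Γ′ (embed ι a) (embed ι a′) v
separated-embed {Edge′ = Edge′} D ι σ ρ Γ′-ι E-map B-map nbr nbr′ refl v∉R′
  with Decomposition.separating D _ _ _ nbr nbr′
... | inj₁ (e , e∈B , Eew) = inj₁ (σ e , B-map e∈B , E-map Eew)
... | inj₂ (u , lcv , p , p≤u , Epw , _) =
        inj₂ (embed ι u , embed-IsLcv ι lcv , embed ι p , embed-P∋ ι p≤u ,
              subst (λ e → Edge′ e _ ≡ true) (sym (Γ′-ι p)) (E-map Epw) , v∉R′)

module Glue {k} {L₁ L₂ L : LIG k} (gl : IsGlue L₁ L₂ L) where
  open IsGlue gl

  LabelledB⊎ : Pred (Fin (nB L₁) ⊎ Fin (nB L₂)) 0ℓ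
  LabelledB⊎ = [ Img (b L₁) , Img (b L₂) ]′

  LabelledR⊎ : Pred (Fin (nR L₁) ⊎ Fin (nR L₂)) 0ℓ
  LabelledR⊎ = [ Img (r L₁) , Img (r L₂) ]′

  σ-injective-outside : ∀ {x y} → σ x ≡ σ y → x ∉ LabelledB⊎ → x ≡ y
  σ-injective-outside = EqClo-injective-outside both-labelled (σ-ker₁ _ _)
    where
    both-labelled : ∀ {x y} → BlueId L₁ L₂ x y → x ∈ LabelledB⊎ × y ∈ LabelledB⊎
    both-labelled (j , _ , _ , bj₁ , bj₂ , refl , refl) = (j , bj₁) , (j , bj₂)

  ρ-injective-outside : ∀ {x y} → ρ x ≡ ρ y → x ∉ LabelledR⊎ → x ≡ y
  ρ-injective-outside = EqClo-injective-outside both-labelled (ρ-ker₁ _ _)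
    where
    both-labelled : ∀ {x y} → RedId L₁ L₂ x y → x ∈ LabelledR⊎ × y ∈ LabelledR⊎
    both-labelled (i , _ , _ , ri₁ , ri₂ , refl , refl) = (i , ri₁) , (i , ri₂)

  b-inj₁ : ∀ {j a} → b L₁ j ≡ just a → b L j ≡ just (σ (inj₁ a))
  b-inj₁ {j} bj = trans (b-def j) (<∣>-left _ _ (b L₂ j) bj)

  b-inj₂ : ∀ {j c} → b L₂ j ≡ just c → b L j ≡ just (σ (inj₂ c))
  b-inj₂ {j} bj = trans (b-def j) (<∣>-right _ _ (b L₁ j) bj λ bj₁ →
                    σ-ker₂ _ _ (base (j , _ , _ , bj₁ , bj , refl , refl)))

  r-inj₁ : ∀ {i a} → r L₁ i ≡ just a → r L i ≡ just (ρ (inj₁ a))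
  r-inj₁ {i} ri = trans (r-def i) (<∣>-left _ _ (r L₂ i) ri)

  r-inj₂ : ∀ {i c} → r L₂ i ≡ just c → r L i ≡ just (ρ (inj₂ c))
  r-inj₂ {i} ri = trans (r-def i) (<∣>-right _ _ (r L₁ i) ri λ ri₁ →
                    ρ-ker₂ _ _ (base (i , _ , _ , ri₁ , ri , refl , refl)))

  σ-labelled : ∀ {x} → x ∈ LabelledB⊎ → σ x ∈ Img (b L)
  σ-labelled {inj₁ _} (j , bj) = j , b-inj₁ bj
  σ-labelled {inj₂ _} (j , bj) = j , b-inj₂ bj

  ρ-labelled : ∀ {y} → y ∈ LabelledR⊎ → ρ y ∈ Img (r L)
  ρ-labelled {inj₁ _} (i , ri) = i , r-inj₁ ri
  ρ-labelled {inj₂ _} (i , ri) = i , r-inj₂ ri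

  σ-unlabelled : ∀ {x} → x ∉ LabelledB⊎ → σ x ∉ Img (b L)
  σ-unlabelled {x} x∉ (j , bj) with <∣>-inv _ _ (b L₁ j) (b L₂ j) (trans (sym (b-def j)) bj)
  ... | inj₁ (a , bj₁ , eq) with σ-injective-outside (sym eq) x∉
  ...   | refl = x∉ (j , bj₁)
  σ-unlabelled {x} x∉ (j , bj) | inj₂ (c , bj₂ , eq) with σ-injective-outside (sym eq) x∉
  ...   | refl = x∉ (j , bj₂)

  edge-origin : ∀ {x v} → x ∉ LabelledB⊎ → E L (σ x) v ≡ true → ∃[ y ] (ρ y ≡ v × SumEdge L₁ L₂ x y)
  edge-origin x∉ Exv with E-img₁ _ _ Exv
  ... | x′ , y , σx′≡σx , ρy≡v , x′y with σ-injective-outside (sym σx′≡σx) x∉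
  ...   | refl = y , ρy≡v , x′y

  same-preimage : ∀ {y y′ v} → ρ y ≡ v → ρ y′ ≡ v → v ∉ Img (r L) → y ≡ y′
  same-preimage {y} ρy ρy′ v∉ =
    ρ-injective-outside (trans ρy (sym ρy′)) (v∉ ∘ subst (Img (r L)) ρy ∘ ρ-labelled {y})

  module Union {d₁ d₂} (D₁ : DecompositionOf L₁ d₁) (D₂ : DecompositionOf L₂ d₂) where
    open Decomposition

    F₁ F₂ F : RootedForest
    F₁ = forest D₁
    F₂ = forest D₂
    F  = F₁ ⊎ᶠ F₂

    n₁ n₂ : ℕ
    n₁ = size F₁
    n₂ = size F₂

    Γ-map : Fin n₁ ⊎ Fin n₂ → Fin (nB L₁) ⊎ Fin (nB L₂)
    Γ-map = Sum.map (Γ D₁) (Γ D₂)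

    Γ⊎ : Vtx F → Fin (nB L₁) ⊎ Fin (nB L₂)
    Γ⊎ = Γ-map ∘ splitAt n₁

    Γ-map-unlabelled : ∀ z → Γ-map z ∉ LabelledB⊎
    Γ-map-unlabelled (inj₁ a) = Γ-unlabelled D₁ a
    Γ-map-unlabelled (inj₂ c) = Γ-unlabelled D₂ c

    Γ⊎-unlabelled : ∀ x → Γ⊎ x ∉ LabelledB⊎
    Γ⊎-unlabelled = Γ-map-unlabelled ∘ splitAt n₁

    σΓ⊎-injective : ∀ x y → σ (Γ⊎ x) ≡ σ (Γ⊎ y) → x ≡ y
    σΓ⊎-injective x y eq =
      splitAt-injective n₁ (⊎-map-injective (Γ-injective D₁ _ _) (Γ-injective D₂ _ _)
        (σ-injective-outside eq (Γ⊎-unlabelled x)))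

    Γ-map-onto : ∀ z → z ∉ LabelledB⊎ → ∃[ y ] (Γ-map y ≡ z)
    Γ-map-onto (inj₁ e) e∉ = Product.map inj₁ (cong inj₁) (Γ-onto D₁ e e∉)
    Γ-map-onto (inj₂ e) e∉ = Product.map inj₂ (cong inj₂) (Γ-onto D₂ e e∉)

    σΓ⊎-onto : ∀ e → e ∉ Img (b L) → ∃[ x ] (σ (Γ⊎ x) ≡ e)
    σΓ⊎-onto e e∉ with σ-surj e
    ... | z , σz≡e with Γ-map-onto z (e∉ ∘ subst (Img (b L)) σz≡e ∘ σ-labelled)
    ...   | y , Γy≡z = join n₁ n₂ y , (begin
      σ (Γ-map (splitAt n₁ (join n₁ n₂ y))) ≡⟨ cong (σ ∘ Γ-map) (splitAt-join n₁ n₂ y) ⟩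
      σ (Γ-map y)                           ≡⟨ cong σ Γy≡z ⟩
      σ z                                   ≡⟨ σz≡e ⟩
      e                                     ∎)
      where open ≡-Reasoning

    Γ⊎-↑ˡ : ∀ a → Γ⊎ (a ↑ˡ n₂) ≡ inj₁ (Γ D₁ a)
    Γ⊎-↑ˡ a = cong Γ-map (splitAt-↑ˡ n₁ a n₂)

    Γ⊎-↑ʳ : ∀ c → Γ⊎ (n₁ ↑ʳ c) ≡ inj₂ (Γ D₂ c)
    Γ⊎-↑ʳ c = cong Γ-map (splitAt-↑ʳ n₁ n₂ c)

    edge-origin-↑ˡ : ∀ {a v} → E L (σ (Γ⊎ (a ↑ˡ n₂))) v ≡ true →
                     ∃[ w ] (ρ (inj₁ w) ≡ v × E L₁ (Γ D₁ a) w ≡ true)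
    edge-origin-↑ˡ {a} Eav with edge-origin (Γ⊎-unlabelled (a ↑ˡ n₂)) Eav
    ... | y , ρy≡v , se rewrite Γ⊎-↑ˡ a with y
    ...   | inj₁ w = w , ρy≡v , se

    edge-origin-↑ʳ : ∀ {c v} → E L (σ (Γ⊎ (n₁ ↑ʳ c))) v ≡ true →
                     ∃[ w ] (ρ (inj₂ w) ≡ v × E L₂ (Γ D₂ c) w ≡ true)
    edge-origin-↑ʳ {c} Ecv with edge-origin (Γ⊎-unlabelled (n₁ ↑ʳ c)) Ecv
    ... | y , ρy≡v , se rewrite Γ⊎-↑ʳ c with y
    ...   | inj₂ w = w , ρy≡v , se

    -- A red vertex unlabelled in L has a single preimage, so both neighbours lie on the same side.
    σΓ⊎-separating : ∀ x x′ v →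
      UnlabelledNbr (E L) (Img (r L)) (σ ∘ Γ⊎) x v → UnlabelledNbr (E L) (Img (r L)) (σ ∘ Γ⊎) x′ v →
      Separated (E L) (Img (r L)) (Img (b L)) F (σ ∘ Γ⊎) x x′ v
    σΓ⊎-separating x x′ v (Exv , v∉) (Ex′v , _) with split n₁ n₂ x | split n₁ n₂ x′
    ... | left a | left a′ with edge-origin-↑ˡ Exv | edge-origin-↑ˡ Ex′v
    ...   | w , ρw , Ew | w′ , ρw′ , Ew′ with same-preimage ρw ρw′ v∉
    ...     | refl = separated-embed {R′ = Img (r L)} D₁ (↑ˡ-embedding F₁ F₂) (σ ∘ inj₁) (ρ ∘ inj₁)
                       (cong σ ∘ Γ⊎-↑ˡ) (E-img₂ (inj₁ _) (inj₁ _)) σ-labelled (Ew , w∉) (Ew′ , w∉) ρw v∉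
      where
      w∉ : w ∉ Img (r L₁)
      w∉ = v∉ ∘ subst (Img (r L)) ρw ∘ ρ-labelled {inj₁ w}
    σΓ⊎-separating x x′ v (Exv , v∉) (Ex′v , _) | right c | right c′
      with edge-origin-↑ʳ Exv | edge-origin-↑ʳ Ex′v
    ...   | w , ρw , Ew | w′ , ρw′ , Ew′ with same-preimage ρw ρw′ v∉
    ...     | refl = separated-embed {R′ = Img (r L)} D₂ (↑ʳ-embedding F₁ F₂) (σ ∘ inj₂) (ρ ∘ inj₂)
                       (cong σ ∘ Γ⊎-↑ʳ) (E-img₂ (inj₂ _) (inj₂ _)) σ-labelled (Ew , w∉) (Ew′ , w∉) ρw v∉
      where
      w∉ : w ∉ Img (r L₂)
      w∉ = v∉ ∘ subst (Img (r L)) ρw ∘ ρ-labelled {inj₂ w}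
    σΓ⊎-separating x x′ v (Exv , v∉) (Ex′v , _) | left a | right c′
      with edge-origin-↑ˡ Exv | edge-origin-↑ʳ Ex′v
    ...   | _ , ρw , _ | _ , ρw′ , _ with same-preimage ρw ρw′ v∉
    ...     | ()
    σΓ⊎-separating x x′ v (Exv , v∉) (Ex′v , _) | right c | left a′
      with edge-origin-↑ʳ Exv | edge-origin-↑ˡ Ex′v
    ...   | _ , ρw , _ | _ , ρw′ , _ with same-preimage ρw ρw′ v∉
    ...     | ()

  glue-decomposition : ∀ {d₁ d₂} → DecompositionOf L₁ d₁ → DecompositionOf L₂ d₂ →
                       DecompositionOf L (d₁ ⊔ d₂)
  glue-decomposition D₁ D₂ = record
    { forest       = F
    ; height       = ⊎ᶠ-height F₁ F₂ (Decomposition.height D₁) (Decomposition.height D₂)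
    ; Γ            = σ ∘ Γ⊎
    ; Γ-injective  = σΓ⊎-injective
    ; Γ-unlabelled = σ-unlabelled ∘ Γ⊎-unlabelled
    ; Γ-onto       = σΓ⊎-onto
    ; separating   = σΓ⊎-separating }
    where open Union D₁ D₂

  glue-guards : RealGuards L₁ → (∀ i j → g L₁ i ≡ nothing → g L₂ i ≡ just j → GuardAt L₂ i j) →
                RealGuards L
  glue-guards guards₁ guards₂ i j gi with g L₁ i in gi₁ | trans (sym (g-def i)) gi
  ... | just j′ | refl with guards₁ i j′ gi₁
  ...   | e , bj , v , ri , Eev =
            σ (inj₁ e) , b-inj₁ bj , ρ (inj₁ v) , r-inj₁ ri , E-img₂ (inj₁ e) (inj₁ v) Eev
  glue-guards guards₁ guards₂ i j gi | nothing | gi₂ with guards₂ i j gi₁ gi₂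
  ...   | e , bj , v , ri , Eev =
            σ (inj₂ e) , b-inj₂ bj , ρ (inj₂ v) , r-inj₂ ri , E-img₂ (inj₂ e) (inj₂ v) Eev

open Glue using (glue-decomposition; glue-guards)

Mf-guards : ∀ {k} {f : ℕ → Maybe (Fin k)} {M} → IsMf f M → RealGuards M
Mf-guards {f = f} {M} Mf i j gi = guard (trans (sym (g-def i)) gi)
  where
  open IsMf Mf
  guard : f i ≡ just j → GuardAt M i j
  guard fi with b M j in bj | r M i in ri
  ... | just e  | just v  = e , refl , v , refl , E-def₂ i j e v ri fi bj
  ... | nothing | _       = ⊥-elim (b-dom₁ j bj (i , fi))
  ... | just _  | nothing with trans (sym (r-dom₁ i ri)) fi
  ...   | ()

∧-trueˡ : ∀ {x y} → x ∧ y ≡ true → x ≡ true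
∧-trueˡ {true} _ = refl

∧-trueʳ : ∀ x {y} → x ∧ y ≡ true → y ≡ true
∧-trueʳ true eq = eq

anyBelow-witness : ∀ N p → anyBelow N p ≡ true → ∃[ i ] (p i ≡ true)
anyBelow-witness (suc N) p eq with p N in pN
... | true  = N , pN
... | false = anyBelow-witness N p eq

eqMF-sound : ∀ {k} (m : Maybe (Fin k)) j → eqMF m j ≡ true → m ≡ just j
eqMF-sound (just a) j eq with a Fin.≟ j
... | yes refl = refl

imgᵇ-sound : ∀ {k} (h : ℕ → Maybe (Fin k)) N j → imgᵇ h N j ≡ true → ∃[ i ] (h i ≡ just j)
imgᵇ-sound h N j eq = Product.map₂ (eqMF-sound (h _) j) (anyBelow-witness N _ eq)

-- If j = g(i) were in img f, the closedness of the transition would put i into dom f.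
transLabels-outside : ∀ {k} {L : LIG k} {f} → IsTransition L f → ∀ {i j} → f i ≡ nothing → g L i ≡ just j →
                      transLabels L f j ≡ false
transLabels-outside {L = L} {f} T {i} {j} fi gi with transLabels L f j in t
... | false = refl
... | true with imgᵇ-sound f (bound L) j (∧-trueˡ (∧-trueʳ (imgᵇ (g L) (bound L) j) t))
...   | i′ , fi′ with IsTransition.closed T i j gi (i′ , fi′)
...     | _ , fi-just with trans (sym fi) fi-just
...       | ()

transition-guards : ∀ {k} {L : LIG k} {f M} → RealGuards L → IsTransition L f → IsMf f M →
                    ∀ i j → g M i ≡ nothing → g (transPrime L f) i ≡ just j → GuardAt (transPrime L f) i j
transition-guards {L = L} {f} guards T Mf i j gMi gi =
  GuardAt-removeBlue L (transLabels L f) (guards i j gi)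
    (transLabels-outside T (trans (sym (IsMf.g-def Mf i)) gMi) gi)

GLI-decomposition : ∀ {k d L} → GLI k d L → DecompositionOf L d × RealGuards L
GLI-decomposition (gli-base L guards (_ , blue-labelled)) = Decomposition-of-labelled blue-labelled , guards
GLI-decomposition (gli-suc G) = Product.map₁ (Decomposition-weaken (n≤1+n _)) (GLI-decomposition G)
GLI-decomposition (gli-glue G₁ G₂ _ gl) with GLI-decomposition G₁ | GLI-decomposition G₂
... | D₁ , guards₁ | D₂ , guards₂ = glue-decomposition gl D₁ D₂ , glue-guards gl guards₁ (λ i j _ → guards₂ i j)
GLI-decomposition (gli-trans {L = L} {f} G T Mf gl) with GLI-decomposition G
... | D , guards =
  glue-decomposition gl (Decomposition-of-labelled (IsMf.b-surj Mf))
                        (removeBlue-decomposition L (transLabels L f) D) ,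
  glue-guards gl (Mf-guards Mf) (transition-guards guards T Mf)
GLI-decomposition (gli-remR {L = L} X _ G) with GLI-decomposition G
... | D , guards = removeRed-decomposition L guards X D , removeRed-guards L guards X
GLI-decomposition (gli-remB {L = L} X removable G) with GLI-decomposition G
... | D , guards = removeBlue-decomposition L X D , removeBlue-guards L guards X kept
  where
  kept : ∀ {i j} → g L i ≡ just j → X j ≡ false
  kept {i} {j} gi with X j in Xj
  ... | false = refl
  ... | true  = ⊥-elim (proj₂ (proj₂ (removable j Xj)) (i , gi))

lemma4p3 : (k : ℕ) → 1 ≤ k → (d : ℕ) → (L : LIG k) → GLI k d L →
    Σ RootedForest (λ F → HeightAtMost F d ×
      Σ (Vtx F → Fin (nB L)) (λ Γ → IsBijToUnlabelled L F Γ × Separating L F Γ))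
lemma4p3 k _ d L G = forest , height , Γ , (Γ-injective , Γ-unlabelled , Γ-onto) , separating′
  where
  open Decomposition (proj₁ (GLI-decomposition G))
  separating′ : Separating L forest Γ
  separating′ s t v nbr-s nbr-t =
    Sum.map₁ (λ { (e , (j , bj) , Eev) → j , e , bj , Eev }) (separating s t v nbr-s nbr-t)
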